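{- Let $G=(V_G,E_G)$ be a finite simple graph with $|V_G|=n\ge2$. Then $G$ is Hamilton-connected if and only if $A_{Ha}(G)=O_n$ (that is, the only edges of $A_{Ha}(G)$ are one loop at each vertex) and $diam_{Ha}(G)=n$.
   Context: For $u,v\in V_G$, $d_{Ha}(u,v)$ is the minimum length of a walk in $G$ from $u$ to $v$ (vertex repetitions allowed) visiting every vertex of $G$, and $d_{Ha}(u,v)=\infty$ if none exists; $diam_{Ha}(G)=\max_{u,v\in V_G}d_{Ha}(u,v)$. The Hamiltonian antipodal graph $A_{Ha}(G)$ is the (not necessarily simple) graph with vertex set $V_G$ in which $u$ and $v$ (possibly $u=v$, giving a loop) are adjacent iff $d_{Ha}(u,v)=diam_{Ha}(G)$. $O_n$ is the graph on $n$ vertices whose edge set consists exactly of one loop at each vertex. $G$ is Hamilton-connected if for every pair of distinct vertices $u,v$ there is a path from $u$ to $v$ visiting every vertex of $G$ exactly once. -}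

module Defs where

open import Data.Nat using (ℕ; zero; suc; _≤_)
open import Data.Fin using (Fin)
open import Data.List using (List; []; _∷_)
open import Data.List.Membership.Propositional using (_∈_)
open import Data.List.Relation.Unary.Unique.Propositional using (Unique)
open import Data.Product using (Σ; ∃; _×_)
open import Data.Unit using (⊤)
open import Data.Empty using (⊥)
open import Relation.Nullary using (¬_; Dec)
open import Relation.Binary.PropositionalEquality using (_≡_; _≢_)

record SimpleGraph (n : ℕ) : Set₁ where
  field
    Adj     : Fin n → Fin n → Set
    Adj?    : ∀ u v → Dec (Adj u v)
    sym     : ∀ {u v} → Adj u v → Adj v u
    irrefl  : ∀ {u} → ¬ Adj u u

module _ {n : ℕ} (G : SimpleGraph n) where
  open SimpleGraph G

  data Walk : Fin n → Fin n → ℕ → Set where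
    here : ∀ u → Walk u u 0
    step : ∀ {u w v k} → Adj u w → Walk w v k → Walk u v (suc k)

  verts : ∀ {u v k} → Walk u v k → List (Fin n)
  verts (here u) = u ∷ []
  verts (step {u} _ w) = u ∷ verts w

  Spanning : ∀ {u v k} → Walk u v k → Set
  Spanning w = ∀ x → x ∈ verts w

  HaWalk : Fin n → Fin n → ℕ → Set
  HaWalk u v k = Σ (Walk u v k) Spanning

data ℕ∞ : Set where
  fin : ℕ → ℕ∞
  ∞   : ℕ∞

_≤∞_ : ℕ∞ → ℕ∞ → Set
fin a ≤∞ fin b = a ≤ b
fin a ≤∞ ∞     = ⊤
∞     ≤∞ fin b = ⊥
∞     ≤∞ ∞     = ⊤

module _ {n : ℕ} (G : SimpleGraph n) where

  IsDHa : Fin n → Fin n → ℕ∞ → Set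
  IsDHa u v (fin k) = HaWalk G u v k × (∀ m → HaWalk G u v m → k ≤ m)
  IsDHa u v ∞       = ∀ m → ¬ HaWalk G u v m

  IsDiamHa : ℕ∞ → Set
  IsDiamHa D = (∀ u v d → IsDHa u v d → d ≤∞ D) × ∃ λ u → ∃ λ v → IsDHa u v D

  -- adjacency (u = v allowed: a loop) in the Hamiltonian antipodal graph A_Ha(G):
  -- d_Ha(u,v) = diam_Ha(G)
  AHaAdj : Fin n → Fin n → Set
  AHaAdj u v = ∃ λ D → IsDiamHa D × IsDHa u v D

  HamiltonConnected : Set
  HamiltonConnected = ∀ u v → u ≢ v →
    ∃ λ k → Σ (Walk G u v k) λ w → Spanning G w × Unique (verts G w)

-- A walk visiting all n vertices lists at least n vertices, so it has length at least n − 1,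
-- and length at least n if it is closed (its first vertex is listed twice).  In a
-- Hamilton-connected graph the bound n − 1 is attained between distinct vertices, and a
-- Hamiltonian path from a neighbour x of u back to u, preceded by the edge ux, attains n
-- for u = v; so d_Ha(u,u) = n is the diameter, attained only on the diagonal.
-- Conversely, if the diameter is n and attained only on the diagonal, then for u ≠ v the
-- value d_Ha(u,v) is finite, below n, and hence equal to n − 1; a spanning walk with n
-- vertex occurrences repeats no vertex, so it is a Hamiltonian path.
module Submission where

open import Defs
open import Data.Nat using (ℕ; zero; suc; pred; _≤_; _<_; z≤n; s≤s)
open import Data.Nat.Properties
  using (≤-refl; ≤-reflexive; ≤-trans; ≤-antisym; <⇒≤; <-irrefl; <-≤-trans; ≮⇒≥; <⇒≱; m≤n⇒m<n∨m≡n; suc-pred; anyUpTo?)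
open import Data.Nat.Induction using (<-rec)
open import Data.Fin using (Fin; zero; suc; _≟_; fromℕ<)
open import Data.Fin.Properties using (injective⇒≤; nonZeroIndex; any?; all?)
open import Data.List using (List; []; _∷_; _++_; _∷ʳ_; length; lookup; allFin)
open import Data.List.Properties using (length-++-sucʳ; ∷ʳ-++; length-tabulate)
open import Data.List.Membership.Propositional using (_∈_)
open import Data.List.Membership.Propositional.Properties using (∈-lookup; ∈-allFin)
import Data.List.Membership.DecPropositional as DecMembership
open import Data.List.Relation.Binary.Subset.Propositional using (_⊆_)
open import Data.List.Relation.Binary.Subset.Propositional.Properties using (⊆-refl; ⊆-trans; ∈-∷⁺ʳ; ++⁺ʳ)
import Data.List.Relation.Unary.All as All
open import Data.List.Relation.Unary.Any using (here; there; index)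
open import Data.List.Relation.Unary.Any.Properties using (lookup-index)
open import Data.List.Relation.Unary.AllPairs using ([]; _∷_)
open import Data.List.Relation.Unary.Unique.Propositional using (Unique)
open import Data.List.Relation.Unary.Unique.Propositional.Properties using (allFin⁺)
open import Data.Product using (Σ; ∃; _×_; _,_; proj₁; proj₂)
open import Data.Sum using (inj₁; inj₂)
open import Data.Unit using (tt)
open import Data.Empty using (⊥-elim)
open import Function using (_∘_; id)
open import Function.Bundles using (_⇔_; mk⇔; Equivalence)
open import Function.Definitions using (Injective)
open import Relation.Nullary using (¬_; Dec; yes; no)
open import Relation.Nullary.Decidable using (map′; _×-dec_)
open import Relation.Unary using (Pred; Decidable)
open import Relation.Binary.PropositionalEquality using (_≡_; _≢_; refl; sym; cong; subst; module ≡-Reasoning)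

≤∞-trans : ∀ {a b c} → a ≤∞ b → b ≤∞ c → a ≤∞ c
≤∞-trans {fin _} {fin _} {fin _} a≤b b≤c = ≤-trans a≤b b≤c
≤∞-trans {fin _} {_}     {∞}     _   _   = tt
≤∞-trans {∞}     {∞}     {∞}     _   _   = tt

minimal-witness : ∀ {p} {P : Pred ℕ p} → Decidable P →
                  ∀ {m} → P m → ∃ λ k → P k × (∀ j → P j → k ≤ j)
minimal-witness {p} {P} P? = <-rec (λ m → P m → Minimal) search _
  where
  Minimal : Set p
  Minimal = ∃ λ k → P k × (∀ j → P j → k ≤ j)

  search : ∀ m → (∀ {i} → i < m → P i → Minimal) → P m → Minimal
  search m rec Pm with anyUpTo? P? m
  ... | yes (i , i<m , Pi) = rec i<m Pi
  ... | no none            = m , Pm , λ j Pj → ≮⇒≥ λ j<m → none (j , j<m , Pj)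

module _ {a} {A : Set a} where

  lookup-injective : ∀ {xs : List A} → Unique xs → Injective _≡_ _≡_ (lookup xs)
  lookup-injective {_ ∷ _} (_   ∷ _)  {zero}  {zero}  _  = refl
  lookup-injective {_ ∷ _} (x∉ ∷ _)  {zero}  {suc j} eq = ⊥-elim (All.lookup x∉ (∈-lookup j) eq)
  lookup-injective {_ ∷ _} (x∉ ∷ _)  {suc i} {zero}  eq = ⊥-elim (All.lookup x∉ (∈-lookup i) (sym eq))
  lookup-injective {_ ∷ _} (_  ∷ un) {suc i} {suc j} eq = cong suc (lookup-injective un eq)

  unique-⊆⇒length≤ : ∀ {zs xs : List A} → Unique zs → zs ⊆ xs → length zs ≤ length xs
  unique-⊆⇒length≤ {zs} {xs} un zs⊆xs = injective⇒≤ position-injective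
    where
    position : Fin (length zs) → Fin (length xs)
    position i = index (zs⊆xs (∈-lookup i))

    position-injective : Injective _≡_ _≡_ position
    position-injective {i} {j} eq = lookup-injective un (begin
      lookup zs i                ≡⟨ lookup-index (zs⊆xs (∈-lookup i)) ⟩
      lookup xs (position i)     ≡⟨ cong (lookup xs) eq ⟩
      lookup xs (position j)     ≡⟨ lookup-index (zs⊆xs (∈-lookup j)) ⟨
      lookup zs j                ∎)
      where open ≡-Reasoning

  ⊆-tight⇒unique : ∀ {zs xs : List A} → Unique zs → zs ⊆ xs → length xs ≤ length zs → Unique xs
  ⊆-tight⇒unique {zs} un = suffix [] _
    where
    suffix : ∀ pre xs → zs ⊆ pre ++ xs → length (pre ++ xs) ≤ length zs → Unique xs
    suffix pre []       _   _   = []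
    suffix pre (y ∷ ys) zs⊆ len = All.tabulate y∉ys ∷ suffix (pre ∷ʳ y) ys
      (subst (zs ⊆_) (sym (∷ʳ-++ pre y ys)) zs⊆)
      (subst (λ l → length l ≤ length zs) (sym (∷ʳ-++ pre y ys)) len)
      where
      y∉ys : ∀ {z} → z ∈ ys → y ≢ z
      y∉ys z∈ys refl = <-irrefl refl (<-≤-trans shorter len)
        where
        shorter : length zs < length (pre ++ y ∷ ys)
        shorter = subst (length zs <_) (sym (length-++-sucʳ pre y ys))
          (s≤s (unique-⊆⇒length≤ un (⊆-trans zs⊆ (++⁺ʳ pre (∈-∷⁺ʳ z∈ys ⊆-refl)))))

other-vertex : ∀ {n} → 2 ≤ n → (u : Fin n) → ∃ λ v → u ≢ v
other-vertex (s≤s (s≤s _)) zero    = suc zero , λ ()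
other-vertex (s≤s (s≤s _)) (suc _) = zero , λ ()

module _ {n : ℕ} where

  Covering : List (Fin n) → Set
  Covering xs = ∀ x → x ∈ xs

  covering⇒n≤length : ∀ {xs} → Covering xs → n ≤ length xs
  covering⇒n≤length {xs} cov = subst (_≤ length xs) (length-tabulate {n = n} id)
    (unique-⊆⇒length≤ {xs = xs} (allFin⁺ n) (λ {x} _ → cov x))

  unique⇒length≤n : ∀ {xs} → Unique xs → length xs ≤ n
  unique⇒length≤n {xs} un = subst (length xs ≤_) (length-tabulate {n = n} id)
    (unique-⊆⇒length≤ {xs = allFin n} un (λ {x} _ → ∈-allFin x))

  covering∧length≤n⇒unique : ∀ {xs} → Covering xs → length xs ≤ n → Unique xs
  covering∧length≤n⇒unique {xs} cov len =
    ⊆-tight⇒unique (allFin⁺ n) (λ {x} _ → cov x)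
      (subst (length xs ≤_) (sym (length-tabulate {n = n} id)) len)

  covering? : Decidable Covering
  covering? xs = all? λ x → DecMembership._∈?_ _≟_ x xs

module _ {n : ℕ} (G : SimpleGraph n) where
  open SimpleGraph G using (Adj?; irrefl)

  HamiltonPath : Fin n → Fin n → ℕ → Set
  HamiltonPath u v k = Σ (Walk G u v k) λ w → Spanning G w × Unique (verts G w)

  length-verts : ∀ {u v k} (w : Walk G u v k) → length (verts G w) ≡ suc k
  length-verts (here _)   = refl
  length-verts (step _ w) = cong suc (length-verts w)

  end∈verts : ∀ {u v k} (w : Walk G u v k) → v ∈ verts G w
  end∈verts (here _)   = here refl
  end∈verts (step _ w) = there (end∈verts w)

  walk? : ∀ k u v {Q : List (Fin n) → Set} → Decidable Q → Dec (Σ (Walk G u v k) (Q ∘ verts G))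
  walk? zero u v Q? with u ≟ v
  ... | no u≢v  = no λ { (here _ , _) → u≢v refl }
  ... | yes refl = map′ (here u ,_) (λ { (here _ , q) → q }) (Q? (u ∷ []))
  walk? (suc k) u v {Q} Q? =
    map′ (λ (_ , a , w , q) → step a w , q) (λ { (step a w , q) → _ , a , w , q })
         (any? λ x → Adj? u x ×-dec walk? k x v {Q ∘ (u ∷_)} (Q? ∘ (u ∷_)))

  haWalk? : ∀ u v k → Dec (HaWalk G u v k)
  haWalk? u v k = walk? k u v covering?

  haWalk-length-≥ : ∀ {u v k} → HaWalk G u v k → n ≤ suc k
  haWalk-length-≥ (w , sp) = subst (n ≤_) (length-verts w) (covering⇒n≤length sp)

  -- The first vertex of a closed walk is listed again at its end, so the tail alone covers.
  closedHaWalk-length-≥ : 2 ≤ n → ∀ {u k} → HaWalk G u u k → n ≤ k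
  closedHaWalk-length-≥ 2≤n (here u , sp) with ≤-trans 2≤n (covering⇒n≤length sp)
  ... | s≤s ()
  closedHaWalk-length-≥ _ (step _ w , sp) =
    subst (n ≤_) (length-verts w) (covering⇒n≤length tail-covers)
    where
    tail-covers : Covering (verts G w)
    tail-covers x with sp x
    ... | here refl = end∈verts w
    ... | there x∈ = x∈

  hamiltonPath-length : ∀ {u v k} → HamiltonPath u v k → suc k ≡ n
  hamiltonPath-length (w , sp , un) =
    ≤-antisym (subst (_≤ n) (length-verts w) (unique⇒length≤n un)) (haWalk-length-≥ (w , sp))

  dHa≤length : ∀ {u v d m} → IsDHa G u v d → HaWalk G u v m → d ≤∞ fin m
  dHa≤length {d = fin _} (_ , least) w = least _ w
  dHa≤length {d = ∞}     none        w = none _ w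

  dHa-of-walk : ∀ {u v m} → HaWalk G u v m → ∃ λ k → IsDHa G u v (fin k)
  dHa-of-walk {u} {v} = minimal-witness (haWalk? u v)

  dHa-defined : ∀ {u v} → ¬ ¬ ∃ (IsDHa G u v)
  dHa-defined undefined = undefined (∞ , λ _ w → undefined (_ , proj₂ (dHa-of-walk w)))

  module HamiltonConnected⇒ (2≤n : 2 ≤ n) (hc : HamiltonConnected G) where

    haWalk-distinct : ∀ {u v} → u ≢ v → ∃ λ k → k < n × HaWalk G u v k
    haWalk-distinct {u} {v} u≢v with hc u v u≢v
    ... | k , path@(w , sp , _) = k , subst (k <_) (hamiltonPath-length path) ≤-refl , w , sp

    closedHaWalk : ∀ u → HaWalk G u u n
    closedHaWalk u with other-vertex 2≤n u
    ... | v , u≢v with hc u v u≢v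
    ... | _ , here _ , _ = ⊥-elim (u≢v refl)
    ... | _ , step {w = x} ux _ , _ with hc x u (λ { refl → irrefl ux })
    ... | _ , path@(w , sp , _) = subst (HaWalk G u u) (hamiltonPath-length path) (step ux w , there ∘ sp)

    dHa-diagonal : ∀ u → IsDHa G u u (fin n)
    dHa-diagonal u = closedHaWalk u , λ _ → closedHaWalk-length-≥ 2≤n

    diamHa : IsDiamHa G (fin n)
    diamHa = bounded , u₀ , u₀ , dHa-diagonal u₀
      where
      u₀ : Fin n
      u₀ = fromℕ< (≤-trans (s≤s z≤n) 2≤n)

      bounded : ∀ u v d → IsDHa G u v d → d ≤∞ fin n
      bounded u v d isd with u ≟ v
      ... | yes refl = dHa≤length isd (closedHaWalk u)
      ... | no u≢v with haWalk-distinct u≢v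
      ... | k , k<n , w = ≤∞-trans {d} (dHa≤length isd w) (<⇒≤ k<n)

    antipodal⇒≡ : ∀ u v → AHaAdj G u v → u ≡ v
    antipodal⇒≡ u v (D , (maximal , _) , isd) with u ≟ v
    ... | yes u≡v = u≡v
    ... | no u≢v with haWalk-distinct u≢v
    ... | k , k<n , w =
      ⊥-elim (<⇒≱ k<n (≤∞-trans {fin n} {D} (maximal u u _ (dHa-diagonal u)) (dHa≤length isd w)))

  module ⇒HamiltonConnected (antipodal : ∀ u v → AHaAdj G u v ⇔ (u ≡ v))
                            (diam : IsDiamHa G (fin n)) where

    shortHaWalk : ∀ {u v} → u ≢ v → HaWalk G u v (pred n)
    shortHaWalk {u} {v} u≢v with haWalk? u v (pred n)
    ... | yes w = w
    ... | no ¬w = ⊥-elim (dHa-defined λ (d , isd) → impossible d isd)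
      where
      impossible : ∀ d → ¬ IsDHa G u v d
      impossible ∞       isd = proj₁ diam u v ∞ isd
      impossible (fin k) isd@(wₖ , _) with m≤n⇒m<n∨m≡n (proj₁ diam u v (fin k) isd)
      ... | inj₂ refl = u≢v (Equivalence.to (antipodal u v) (fin n , diam , isd))
      ... | inj₁ k<n  = ¬w (subst (HaWalk G u v) (cong pred (≤-antisym k<n (haWalk-length-≥ wₖ))) wₖ)

    hamiltonConnected : HamiltonConnected G
    hamiltonConnected u v u≢v with shortHaWalk u≢v
    ... | w , sp = pred n , w , sp ,
      covering∧length≤n⇒unique sp
        (subst (_≤ n) (sym (length-verts w)) (≤-reflexive (suc-pred n {{nonZeroIndex u}})))

proposition4p17 : (n : ℕ) → 2 ≤ n → (G : SimpleGraph n) →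
    HamiltonConnected G ⇔
      ((∀ (u v : Fin n) → AHaAdj G u v ⇔ (u ≡ v)) × IsDiamHa G (fin n))
proposition4p17 n 2≤n G = mk⇔ forward backward
  where
  forward : HamiltonConnected G → (∀ u v → AHaAdj G u v ⇔ (u ≡ v)) × IsDiamHa G (fin n)
  forward hc = (λ u v → mk⇔ (antipodal⇒≡ u v) λ { refl → fin n , diamHa , dHa-diagonal u }) , diamHa
    where open HamiltonConnected⇒ G 2≤n hc

  backward : (∀ u v → AHaAdj G u v ⇔ (u ≡ v)) × IsDiamHa G (fin n) → HamiltonConnected G
  backward (antipodal , diam) = ⇒HamiltonConnected.hamiltonConnected G antipodal diam
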